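{- For every positive integer $n$, $$\Phi^{(3)}[a, a'; bq^n, b'; c; x, y] = \Phi^{(3)}[a, a'; b, b'; c; x, y] + \frac{bx(1-a)}{1-c} \sum_{k=1}^n q^{k-1} \Phi^{(3)}[aq, a'; bq^k, b'; cq; x, y],$$ and $$\Phi^{(3)}[a, a'; bq^{ -n}, b'; c; x, y] = \Phi^{(3)}[a, a'; b, b'; c; x, y] - \frac{bx(1-a)}{1-c} \sum_{k=1}^n q^{ -k} \Phi^{(3)}[aq, a'; bq^{1-k}, b'; cq; x, y].$$
   Context: Let $q$ be a complex number with $|q|<1$. For a complex number $z$ and an integer $N\ge 0$, $(z;q)_N=\prod_{j=0}^{N-1}(1-zq^j)$. The $q$-Appell function $\Phi^{(3)}$ is $$\Phi^{(3)}[a, a'; b, b'; c; x, y] = \sum_{m, n \geq 0} \frac{(a; q)_m (a'; q)_n (b; q)_m (b'; q)_n}{(q; q)_m (q; q)_n (c; q)_{m+n}} x^m y^n .$$ All identities are understood as identities of power series in $x,y$ (convergent for $|x|,|y|$ sufficiently small), with parameters generic so that no denominator appearing vanishes. -}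

module Defs where

open import Level using (_⊔_)
open import Data.Nat using (ℕ; zero; suc) renaming (_+_ to _+ℕ_)
open import Data.Product using (_×_)
open import Relation.Nullary using (¬_)
open import Algebra.Bundles using (CommutativeRing)

-- Everything is developed over a commutative ring R together with a
-- function inv that inverts every nonzero element (i.e. R is a field;
-- the stdlib has no Field bundle). ℂ is the intended instance.
module QSeries {c ℓ} (R : CommutativeRing c ℓ) (inv : CommutativeRing.Carrier R → CommutativeRing.Carrier R) where
  open CommutativeRing R

  InvLaw : Set (c ⊔ ℓ)
  InvLaw = ∀ z → ¬ (z ≈ 0#) → z * inv z ≈ 1#

  pow : Carrier → ℕ → Carrier
  pow z zero    = 1#
  pow z (suc k) = z * pow z k

  poch : Carrier → Carrier → ℕ → Carrier
  poch z q zero    = 1#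
  poch z q (suc N) = poch z q N * (1# - z * pow q N)

  -- formal power series in x, y: coefficient of x^m y^n
  Series : Set c
  Series = ℕ → ℕ → Carrier

  _≋_ : Series → Series → Set ℓ
  F ≋ G = ∀ m n → F m n ≈ G m n

  _⊕_ : Series → Series → Series
  (F ⊕ G) m n = F m n + G m n

  _⊖_ : Series → Series → Series
  (F ⊖ G) m n = F m n - G m n

  _⊙_ : Carrier → Series → Series
  (k ⊙ F) m n = k * F m n

  timesX : Series → Series
  timesX F zero    n = 0#
  timesX F (suc m) n = F m n

  -- finite sum  Σ_{k=1}^{N} f k
  sumSeries : ℕ → (ℕ → Series) → Series
  sumSeries zero    f = λ _ _ → 0#
  sumSeries (suc N) f = sumSeries N f ⊕ f (suc N)

  Phi3 : (q a a' b b' cc : Carrier) → Series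
  Phi3 q a a' b b' cc m n =
    (poch a q m * poch a' q n * poch b q m * poch b' q n)
      * inv (poch q q m * poch q q n * poch cc q (m +ℕ n))

module Submission where

-- Write Φ[b] for Φ⁽³⁾[a, a'; b, b'; c; x, y], Φ⁺[b] for
-- Φ⁽³⁾[aq, a'; b, b'; cq; x, y] and K(b) = b(1 - a)/(1 - c).  The whole
-- theorem rests on one three-term relation, the contiguous relation
--
--     Φ[bq] = Φ[b] + x · K(b) · Φ⁺[bq],
--
-- which is checked coefficientwise: for the coefficient of x^(m+1) y^j it
-- follows from (bq;q)_(m+1) - (b;q)_(m+1) = b (1 - q^(m+1)) (bq;q)_m and
-- (z;q)_(N+1) = (1 - z) (zq;q)_N, after clearing denominators.
-- Applying it to b q^k (resp. b q^-(k+1)) gives one step up (resp. down)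
-- of the ladder b, bq, bq², … (resp. b, b/q, b/q², …), and a telescoping
-- lemma for sequences of power series sums these steps to the two
-- identities of the theorem.

open import Defs
open import Data.Nat using (ℕ; zero; suc; _≤_; pred) renaming (_+_ to _+ℕ_)
open import Data.Product using (_×_; _,_; proj₁; proj₂)
open import Relation.Nullary using (¬_)
open import Algebra.Bundles using (CommutativeRing)
import Algebra.Solver.CommutativeMonoid as CommutativeMonoidSolver

module ContiguousRelations
  {c ℓ} (R : CommutativeRing c ℓ)
  (inv : CommutativeRing.Carrier R → CommutativeRing.Carrier R)
  (inv-law : QSeries.InvLaw R inv) where

  open CommutativeRing R
  open QSeries R inv
  open import Algebra.Properties.Ring ring using (x[y-z]≈xy-xz; [y-z]x≈yx-zx)
  open import Algebra.Properties.AbelianGroup +-abelianGroup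
    using (ε⁻¹≈ε; ⁻¹-anti-homo‿-; ⁻¹-∙-comm; //-rightDividesˡ; //-rightDividesʳ)
  open import Relation.Binary.Reasoning.Setoid setoid
  open CommutativeMonoidSolver *-commutativeMonoid
    using (solve; _⊜_) renaming (_⊕_ to infixl 7 _∙_)

  x≈y+[x-y] : ∀ x y → x ≈ y + (x - y)
  x≈y+[x-y] x y = sym (trans (+-comm y (x - y)) (//-rightDividesˡ y x))

  solve-for-summand : ∀ {x y z} → x ≈ y + z → y ≈ x - z
  solve-for-summand {x} {y} {z} x≈y+z = trans (sym (//-rightDividesʳ z y)) (+-congʳ (sym x≈y+z))

  x-0≈x : ∀ x → x - 0# ≈ x
  x-0≈x x = trans (+-congˡ ε⁻¹≈ε) (+-identityʳ x)

  x-y-z≈x-[y+z] : ∀ x y z → x - y - z ≈ x - (y + z)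
  x-y-z≈x-[y+z] x y z = trans (+-assoc x (- y) (- z)) (+-congˡ (⁻¹-∙-comm y z))

  [p-r]-[p-s]≈s-r : ∀ p r s → (p - r) - (p - s) ≈ s - r
  [p-r]-[p-s]≈s-r p r s = begin
    (p - r) - (p - s)  ≈⟨ +-congˡ (⁻¹-anti-homo‿- p s) ⟩
    (p - r) + (s - p)  ≈⟨ +-comm (p - r) (s - p) ⟩
    (s - p) + (p - r)  ≈⟨ +-assoc (s - p) p (- r) ⟨
    (s - p) + p - r    ≈⟨ +-congʳ (//-rightDividesˡ p s) ⟩
    s - r              ∎

  difference-in-factor : ∀ A B X Y C → A * B * X * C - A * B * Y * C ≈ A * B * (X - Y) * C
  difference-in-factor A B X Y C = begin
    A * B * X * C - A * B * Y * C  ≈⟨ [y-z]x≈yx-zx C (A * B * X) (A * B * Y) ⟨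
    (A * B * X - A * B * Y) * C    ≈⟨ *-congʳ (x[y-z]≈xy-xz (A * B) X Y) ⟨
    A * B * (X - Y) * C            ∎

  nonzero-factors : ∀ {x y} → ¬ x * y ≈ 0# → ¬ x ≈ 0# × ¬ y ≈ 0#
  nonzero-factors {x} {y} xy≉0 =
    (λ x≈0 → xy≉0 (trans (*-congʳ x≈0) (zeroˡ y))) ,
    (λ y≈0 → xy≉0 (trans (*-congˡ y≈0) (zeroʳ x)))

  mul-inv-cancel : ∀ {z} → ¬ z ≈ 0# → ∀ x → x * (z * inv z) ≈ x
  mul-inv-cancel {z} z≉0 x = trans (*-congˡ (inv-law z z≉0)) (*-identityʳ x)

  *-cancelʳ : ∀ {x y z} → ¬ z ≈ 0# → x * z ≈ y * z → x ≈ y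
  *-cancelʳ {x} {y} {z} z≉0 xz≈yz = begin
    x                ≈⟨ mul-inv-cancel z≉0 x ⟨
    x * (z * inv z)  ≈⟨ *-assoc x z (inv z) ⟨
    x * z * inv z    ≈⟨ *-congʳ xz≈yz ⟩
    y * z * inv z    ≈⟨ *-assoc y z (inv z) ⟩
    y * (z * inv z)  ≈⟨ mul-inv-cancel z≉0 y ⟩
    y                ∎

  nonzero-* : ∀ {x y} → ¬ x ≈ 0# → ¬ y ≈ 0# → ¬ x * y ≈ 0#
  nonzero-* {x} {y} x≉0 y≉0 xy≈0 = x≉0 (*-cancelʳ y≉0 (trans xy≈0 (sym (zeroˡ y))))

  inv-* : ∀ {x y} → ¬ x ≈ 0# → ¬ y ≈ 0# → inv (x * y) ≈ inv x * inv y
  inv-* {x} {y} x≉0 y≉0 = *-cancelʳ (nonzero-* x≉0 y≉0) (begin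
    inv (x * y) * (x * y)            ≈⟨ *-comm (inv (x * y)) (x * y) ⟩
    x * y * inv (x * y)              ≈⟨ inv-law (x * y) (nonzero-* x≉0 y≉0) ⟩
    1#                               ≈⟨ *-identityʳ 1# ⟨
    1# * 1#                          ≈⟨ *-cong (inv-law x x≉0) (inv-law y y≉0) ⟨
    x * inv x * (y * inv y)          ≈⟨ solve 4 (λ x x' y y' → x ∙ x' ∙ (y ∙ y') ⊜ x' ∙ y' ∙ (x ∙ y)) refl x (inv x) y (inv y) ⟩
    inv x * inv y * (x * y)          ∎)

  cross-multiply : ∀ {u w Y Z} → ¬ Y ≈ 0# → ¬ Z ≈ 0# → u * Z ≈ w * Y → u * inv Y ≈ w * inv Z
  cross-multiply {u} {w} {Y} {Z} Y≉0 Z≉0 uZ≈wY = *-cancelʳ (nonzero-* Y≉0 Z≉0) (begin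
    u * inv Y * (Y * Z)    ≈⟨ solve 4 (λ u y' y z → u ∙ y' ∙ (y ∙ z) ⊜ u ∙ z ∙ (y ∙ y')) refl u (inv Y) Y Z ⟩
    u * Z * (Y * inv Y)    ≈⟨ mul-inv-cancel Y≉0 (u * Z) ⟩
    u * Z                  ≈⟨ uZ≈wY ⟩
    w * Y                  ≈⟨ mul-inv-cancel Z≉0 (w * Y) ⟨
    w * Y * (Z * inv Z)    ≈⟨ solve 4 (λ w y z z' → w ∙ y ∙ (z ∙ z') ⊜ w ∙ z' ∙ (y ∙ z)) refl w Y Z (inv Z) ⟩
    w * inv Z * (Y * Z)    ∎)

  module Pochhammer (q : Carrier) where

    poch-cong : ∀ {z w} → z ≈ w → ∀ N → poch z q N ≈ poch w q N
    poch-cong z≈w zero    = refl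
    poch-cong z≈w (suc N) = *-cong (poch-cong z≈w N) (+-congˡ (-‿cong (*-congʳ z≈w)))

    poch-shift : ∀ z N → poch z q (suc N) ≈ (1# - z) * poch (z * q) q N
    poch-shift z zero = begin
      1# * (1# - z * 1#)  ≈⟨ *-identityˡ _ ⟩
      1# - z * 1#         ≈⟨ +-congˡ (-‿cong (*-identityʳ z)) ⟩
      1# - z              ≈⟨ *-identityʳ _ ⟨
      (1# - z) * 1#       ∎
    poch-shift z (suc N) = begin
      poch z q (suc N) * (1# - z * (q * pow q N))
        ≈⟨ *-cong (poch-shift z N) (+-congˡ (-‿cong (sym (*-assoc z q (pow q N))))) ⟩
      (1# - z) * poch (z * q) q N * (1# - z * q * pow q N)
        ≈⟨ *-assoc _ _ _ ⟩
      (1# - z) * (poch (z * q) q N * (1# - z * q * pow q N))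
        ∎

    poch-step : ∀ z N → poch (z * q) q (suc N) - poch z q (suc N)
                        ≈ z * (1# - pow q (suc N)) * poch (z * q) q N
    poch-step z N = begin
      X * (1# - z * q * pow q N) - poch z q (suc N)
        ≈⟨ +-cong (*-congˡ (+-congˡ (-‿cong (*-assoc z q (pow q N)))))
                  (-‿cong (trans (poch-shift z N) (*-comm (1# - z) X))) ⟩
      X * (1# - z * t) - X * (1# - z)  ≈⟨ x[y-z]≈xy-xz X (1# - z * t) (1# - z) ⟨
      X * ((1# - z * t) - (1# - z))    ≈⟨ *-congˡ ([p-r]-[p-s]≈s-r 1# (z * t) z) ⟩
      X * (z - z * t)                  ≈⟨ *-congˡ (+-congʳ (*-identityʳ z)) ⟨
      X * (z * 1# - z * t)             ≈⟨ *-congˡ (x[y-z]≈xy-xz z 1# t) ⟨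
      X * (z * (1# - t))               ≈⟨ *-comm X (z * (1# - t)) ⟩
      z * (1# - t) * X                 ∎
      where
      X t : Carrier
      X = poch (z * q) q N
      t = pow q (suc N)

    Phi3-cong-b : ∀ {a a' b₁ b₂ b' cc} → b₁ ≈ b₂ → Phi3 q a a' b₁ b' cc ≋ Phi3 q a a' b₂ b' cc
    Phi3-cong-b b₁≈b₂ m n = *-congʳ (*-congʳ (*-congˡ (poch-cong b₁≈b₂ m)))

  timesX-⊙-⊕ : ∀ κ F G m n → timesX (κ ⊙ (F ⊕ G)) m n ≈ timesX (κ ⊙ F) m n + timesX (κ ⊙ G) m n
  timesX-⊙-⊕ κ F G zero    n = sym (+-identityʳ 0#)
  timesX-⊙-⊕ κ F G (suc m) n = distribˡ κ (F m n) (G m n)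

  timesX-⊙-empty : ∀ κ (G : ℕ → Series) m n → timesX (κ ⊙ sumSeries 0 G) m n ≈ 0#
  timesX-⊙-empty κ G zero    n = refl
  timesX-⊙-empty κ G (suc m) n = zeroʳ κ

  telescope-⊕ : ∀ (F : ℕ → Series) {G : ℕ → Series} {H κ} → F 0 ≋ H →
                (∀ k → F (suc k) ≋ (F k ⊕ timesX (κ ⊙ G (suc k)))) →
                ∀ n → F n ≋ (H ⊕ timesX (κ ⊙ sumSeries n G))
  telescope-⊕ F {G} {H} {κ} base step zero m j =
    trans (base m j) (sym (trans (+-congˡ (timesX-⊙-empty κ G m j)) (+-identityʳ (H m j))))
  telescope-⊕ F {G} {H} {κ} base step (suc n) m j = begin
    F (suc n) m j                                      ≈⟨ step n m j ⟩
    F n m j + timesX (κ ⊙ G (suc n)) m j               ≈⟨ +-congʳ (telescope-⊕ F base step n m j) ⟩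
    H m j + timesX (κ ⊙ sumSeries n G) m j + timesX (κ ⊙ G (suc n)) m j
                                                       ≈⟨ +-assoc _ _ _ ⟩
    H m j + (timesX (κ ⊙ sumSeries n G) m j + timesX (κ ⊙ G (suc n)) m j)
                                                       ≈⟨ +-congˡ (timesX-⊙-⊕ κ (sumSeries n G) (G (suc n)) m j) ⟨
    H m j + timesX (κ ⊙ sumSeries (suc n) G) m j       ∎

  telescope-⊖ : ∀ (F : ℕ → Series) {G : ℕ → Series} {H κ} → F 0 ≋ H →
                (∀ k → F (suc k) ≋ (F k ⊖ timesX (κ ⊙ G (suc k)))) →
                ∀ n → F n ≋ (H ⊖ timesX (κ ⊙ sumSeries n G))
  telescope-⊖ F {G} {H} {κ} base step zero m j =
    trans (base m j) (sym (trans (+-congˡ (-‿cong (timesX-⊙-empty κ G m j))) (x-0≈x (H m j))))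
  telescope-⊖ F {G} {H} {κ} base step (suc n) m j = begin
    F (suc n) m j                                      ≈⟨ step n m j ⟩
    F n m j - timesX (κ ⊙ G (suc n)) m j               ≈⟨ +-congʳ (telescope-⊖ F base step n m j) ⟩
    H m j - timesX (κ ⊙ sumSeries n G) m j - timesX (κ ⊙ G (suc n)) m j
                                                       ≈⟨ x-y-z≈x-[y+z] _ _ _ ⟩
    H m j - (timesX (κ ⊙ sumSeries n G) m j + timesX (κ ⊙ G (suc n)) m j)
                                                       ≈⟨ +-congˡ (-‿cong (timesX-⊙-⊕ κ (sumSeries n G) (G (suc n)) m j)) ⟨
    H m j - timesX (κ ⊙ sumSeries (suc n) G) m j       ∎

  module Appell (q a a' b' cc : Carrier) (q≉0 : ¬ q ≈ 0#)
                (poch-q≉0 : ∀ N → ¬ poch q q N ≈ 0#)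
                (poch-c≉0 : ∀ N → ¬ poch cc q N ≈ 0#) where

    open Pochhammer q

    Φ : Carrier → Series
    Φ b = Phi3 q a a' b b' cc

    Φ⁺ : Carrier → Series
    Φ⁺ b = Phi3 q (a * q) a' b b' (cc * q)

    K : Carrier → Carrier
    K b = b * (1# - a) * inv (1# - cc)

    K-scale : ∀ b p y → K (b * p) * y ≈ K b * (p * y)
    K-scale b p y = solve 5 (λ b p u v y → b ∙ p ∙ u ∙ v ∙ y ⊜ b ∙ u ∙ v ∙ (p ∙ y)) refl
                      b p (1# - a) (inv (1# - cc)) y

    shifted-nonzero : ∀ N → ¬ (1# - cc) ≈ 0# × ¬ poch (cc * q) q N ≈ 0#
    shifted-nonzero N = nonzero-factors (λ e → poch-c≉0 (suc N) (trans (poch-shift cc N) e))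

    contiguous-coeff : ∀ b m j → Φ (b * q) (suc m) j ≈ Φ b (suc m) j + K b * Φ⁺ (b * q) m j
    contiguous-coeff b m j = begin
      Nq * inv D                   ≈⟨ *-congʳ (x≈y+[x-y] Nq Nb) ⟩
      (Nb + (Nq - Nb)) * inv D     ≈⟨ distribʳ (inv D) Nb (Nq - Nb) ⟩
      Nb * inv D + (Nq - Nb) * inv D
        ≈⟨ +-congˡ (cross-multiply D≉0 (nonzero-* 1-c≉0 D⁺≉0) cleared) ⟩
      Nb * inv D + b * (1# - a) * N⁺ * inv ((1# - cc) * D⁺)
        ≈⟨ +-congˡ (*-congˡ (inv-* 1-c≉0 D⁺≉0)) ⟩
      Nb * inv D + b * (1# - a) * N⁺ * (inv (1# - cc) * inv D⁺)
        ≈⟨ +-congˡ (solve 4 (λ u n c' d' → u ∙ n ∙ (c' ∙ d') ⊜ u ∙ c' ∙ (n ∙ d')) refl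
                      (b * (1# - a)) N⁺ (inv (1# - cc)) (inv D⁺)) ⟩
      Nb * inv D + K b * (N⁺ * inv D⁺) ∎
      where
      A⁺ pa' pb' X t Qm Qj C⁺ Nq Nb D N⁺ D⁺ : Carrier
      A⁺ = poch (a * q) q m
      pa' = poch a' q j
      pb' = poch b' q j
      X = poch (b * q) q m
      t = pow q (suc m)
      Qm = poch q q m
      Qj = poch q q j
      C⁺ = poch (cc * q) q (m +ℕ j)
      Nq = poch a q (suc m) * pa' * poch (b * q) q (suc m) * pb'
      Nb = poch a q (suc m) * pa' * poch b q (suc m) * pb'
      D = poch q q (suc m) * Qj * poch cc q (suc m +ℕ j)
      N⁺ = A⁺ * pa' * X * pb'
      D⁺ = Qm * Qj * C⁺
      1-c≉0 : ¬ (1# - cc) ≈ 0#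
      1-c≉0 = proj₁ (shifted-nonzero 0)
      D⁺≉0 : ¬ D⁺ ≈ 0#
      D⁺≉0 = nonzero-* (nonzero-* (poch-q≉0 m) (poch-q≉0 j)) (proj₂ (shifted-nonzero (m +ℕ j)))
      D≉0 : ¬ D ≈ 0#
      D≉0 = nonzero-* (nonzero-* (poch-q≉0 (suc m)) (poch-q≉0 j)) (poch-c≉0 (suc m +ℕ j))
      cleared : (Nq - Nb) * ((1# - cc) * D⁺) ≈ b * (1# - a) * N⁺ * D
      cleared = begin
        (Nq - Nb) * ((1# - cc) * D⁺)
          ≈⟨ *-congʳ (difference-in-factor (poch a q (suc m)) pa' _ _ pb') ⟩
        poch a q (suc m) * pa' * (poch (b * q) q (suc m) - poch b q (suc m)) * pb' * ((1# - cc) * D⁺)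
          ≈⟨ *-congʳ (*-congʳ (*-cong (*-congʳ (poch-shift a m)) (poch-step b m))) ⟩
        (1# - a) * A⁺ * pa' * (b * (1# - t) * X) * pb' * ((1# - cc) * (Qm * Qj * C⁺))
          ≈⟨ solve 11 (λ a₁ A p b₁ t₁ x r c₁ m₁ j₁ C →
                 a₁ ∙ A ∙ p ∙ (b₁ ∙ t₁ ∙ x) ∙ r ∙ (c₁ ∙ (m₁ ∙ j₁ ∙ C))
               ⊜ b₁ ∙ a₁ ∙ (A ∙ p ∙ x ∙ r) ∙ (m₁ ∙ t₁ ∙ j₁ ∙ (c₁ ∙ C))) refl
               (1# - a) A⁺ pa' b (1# - t) X pb' (1# - cc) Qm Qj C⁺ ⟩
        b * (1# - a) * N⁺ * (Qm * (1# - t) * Qj * ((1# - cc) * C⁺))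
          ≈⟨ *-congˡ (*-congˡ (poch-shift cc (m +ℕ j))) ⟨
        b * (1# - a) * N⁺ * D ∎

    contiguous : ∀ b p {b₁} → b * p * q ≈ b₁ →
                 Φ b₁ ≋ (Φ (b * p) ⊕ timesX (K b ⊙ (p ⊙ Φ⁺ b₁)))
    contiguous b p e zero    j = sym (+-identityʳ _)
    contiguous b p e (suc m) j = begin
      Φ _ (suc m) j                                    ≈⟨ Phi3-cong-b (sym e) (suc m) j ⟩
      Φ (b * p * q) (suc m) j                          ≈⟨ contiguous-coeff (b * p) m j ⟩
      Φ (b * p) (suc m) j + K (b * p) * Φ⁺ (b * p * q) m j
                                                       ≈⟨ +-congˡ (*-congˡ (Phi3-cong-b e m j)) ⟩
      Φ (b * p) (suc m) j + K (b * p) * Φ⁺ _ m j       ≈⟨ +-congˡ (K-scale b p _) ⟩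
      Φ (b * p) (suc m) j + K b * (p * Φ⁺ _ m j)       ∎

    step-up : ∀ b k → Φ (b * pow q (suc k)) ≋ (Φ (b * pow q k) ⊕ timesX (K b ⊙ (pow q k ⊙ Φ⁺ (b * pow q (suc k)))))
    step-up b k = contiguous b (pow q k)
      (solve 3 (λ b p q → b ∙ p ∙ q ⊜ b ∙ (q ∙ p)) refl b (pow q k) q)

    step-down : ∀ b k →
      Φ (b * pow (inv q) (suc k))
        ≋ (Φ (b * pow (inv q) k) ⊖ timesX (K b ⊙ (pow (inv q) (suc k) ⊙ Φ⁺ (b * q * pow (inv q) (suc k)))))
    step-down b k m j =
      solve-for-summand (trans (Phi3-cong-b undo-step m j)
        (contiguous b p (solve 3 (λ b p q → b ∙ p ∙ q ⊜ b ∙ q ∙ p) refl b p q) m j))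
      where
      p : Carrier
      p = pow (inv q) (suc k)
      undo-step : b * pow (inv q) k ≈ b * q * p
      undo-step = begin
        b * pow (inv q) k                  ≈⟨ mul-inv-cancel q≉0 _ ⟨
        b * pow (inv q) k * (q * inv q)    ≈⟨ solve 4 (λ b r q q' → b ∙ r ∙ (q ∙ q') ⊜ b ∙ q ∙ (q' ∙ r)) refl
                                                b (pow (inv q) k) q (inv q) ⟩
        b * q * p                          ∎

theorem11 : ∀ {c ℓ} (R : CommutativeRing c ℓ) (inv : CommutativeRing.Carrier R → CommutativeRing.Carrier R) →
    QSeries.InvLaw R inv →
    let open CommutativeRing R
        open QSeries R inv
    in (q a a' b b' cc : Carrier) →
    ¬ (q ≈ 0#) →
    (∀ N → ¬ (poch q q N ≈ 0#)) →
    (∀ N → ¬ (poch cc q N ≈ 0#)) →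
    (n : ℕ) → 1 ≤ n →
    (Phi3 q a a' (b * pow q n) b' cc
      ≋ (Phi3 q a a' b b' cc
         ⊕ timesX ((b * (1# - a) * inv (1# - cc))
           ⊙ sumSeries n (λ k → pow q (pred k) ⊙ Phi3 q (a * q) a' (b * pow q k) b' (cc * q)))))
    ×
    (Phi3 q a a' (b * pow (inv q) n) b' cc
      ≋ (Phi3 q a a' b b' cc
         ⊖ timesX ((b * (1# - a) * inv (1# - cc))
           ⊙ sumSeries n (λ k → pow (inv q) k ⊙ Phi3 q (a * q) a' (b * q * pow (inv q) k) b' (cc * q)))))
-- both identities hold for every n
theorem11 R inv inv-law q a a' b b' cc q≉0 poch-q≉0 poch-c≉0 n _ =
  telescope-⊕ (λ k → Φ (b * pow q k)) base (step-up b) n ,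
  telescope-⊖ (λ k → Φ (b * pow (inv q) k)) base (step-down b) n
  where
  open CommutativeRing R using (_*_; 1#; *-identityʳ)
  open QSeries R inv using (pow; _≋_)
  open ContiguousRelations R inv inv-law
  open Pochhammer q using (Phi3-cong-b)
  open Appell q a a' b' cc q≉0 poch-q≉0 poch-c≉0
  base : Φ (b * 1#) ≋ Φ b
  base = Phi3-cong-b (*-identityʳ b)
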